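{- Let $\widehat{\mathcal M}=(S\cup T\cup\{q\},\widehat{\mathcal C})$ be an oriented matroid with $S=\{s_1,\dots,s_n\}$, $T=\{t_1,\dots,t_n\}$. Suppose there are two distinct complementary circuits $X,Y\in\widehat{\mathcal C}$ with $X_q=Y_q=+$ such that for all $i\in[n]$, either $X_{s_i}Y_{t_i}=X_{t_i}Y_{s_i}=0$, or $X_{s_i}=Y_{t_i}$ and $X_{t_i}=Y_{s_i}$. Then $\widehat{\mathcal M}$ is not a P-matroid extension.
   Context: Oriented matroids are given by circuits: signed sets $X\in\{ -,0,+\}^E$ (with $X^+,X^-$ the sets of positive/negative entries and support $X^+\cup X^-$) satisfying (C0) $0\notin\mathcal C$; (C1) $X\in\mathcal C\iff-X\in\mathcal C$; (C2) if supports satisfy $\underline X\subseteq\underline Y$ then $X=\pm Y$; (C3) for $X\neq-Y$ and $e\in X^+\cap Y^-$ there is $Z\in\mathcal C$ with $Z^+\subseteq(X^+\cup Y^+)\setminus\{e\}$, $Z^-\subseteq(X^-\cup Y^-)\setminus\{e\}$. A set or circuit is complementary if it (its support) contains no pair $\{s_i,t_i\}$. An oriented matroid on $S\cup T$ is a P-matroid if $S$ is a basis and no circuit $X$ is sign-reversing, i.e., satisfies $X_{s_i}=-X_{t_i}$ for every $i$ with $\{s_i,t_i\}\subseteq$ support of $X$. $\widehat{\mathcal M}$ is a P-matroid extension if the oriented matroid on $S\cup T$ whose circuits are those circuits of $\widehat{\mathcal M}$ with $X_q=0$ (restricted to $S\cup T$) is a P-matroid. -}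

module Defs where

open import Data.Nat using (ℕ)
open import Data.Fin using (Fin)
open import Data.Product using (Σ; ∃; _×_; _,_)
open import Data.Sum using (_⊎_)
open import Data.Unit using (⊤)
open import Data.Empty using (⊥)
open import Relation.Nullary using (¬_)
open import Relation.Binary.PropositionalEquality using (_≡_)

data Sign : Set where
  ⊖ ⊙ ⊕ : Sign

negS : Sign → Sign
negS ⊖ = ⊕
negS ⊙ = ⊙
negS ⊕ = ⊖

_·_ : Sign → Sign → Sign
⊙ · _ = ⊙
_ · ⊙ = ⊙
⊕ · y = y
⊖ · y = negS y

SignedSet : Set → Set
SignedSet E = E → Sign

neg : {E : Set} → SignedSet E → SignedSet E
neg X e = negS (X e)

_≗ₛ_ : {E : Set} → SignedSet E → SignedSet E → Set
X ≗ₛ Y = ∀ e → X e ≡ Y e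

InSupp : {E : Set} → SignedSet E → E → Set
InSupp X e = ¬ (X e ≡ ⊙)

-- circuit axioms (C0)–(C3); 'ext' says the family is a family of signed
-- sets, i.e. invariant under pointwise equality (automatic set-theoretically)
record IsOrientedMatroid {E : Set} (𝒞 : SignedSet E → Set) : Set where
  field
    ext : ∀ X Y → X ≗ₛ Y → 𝒞 X → 𝒞 Y
    C0  : ∀ X → 𝒞 X → ¬ (∀ e → X e ≡ ⊙)
    C1  : ∀ X → (𝒞 X → 𝒞 (neg X)) × (𝒞 (neg X) → 𝒞 X)
    C2  : ∀ X Y → 𝒞 X → 𝒞 Y → (∀ e → InSupp X e → InSupp Y e) →
          (X ≗ₛ Y) ⊎ (X ≗ₛ neg Y)
    C3  : ∀ X Y → 𝒞 X → 𝒞 Y → ¬ (X ≗ₛ neg Y) → ∀ e → X e ≡ ⊕ → Y e ≡ ⊖ →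
          Σ (SignedSet E) λ Z → 𝒞 Z ×
            (∀ f → Z f ≡ ⊕ → (X f ≡ ⊕ ⊎ Y f ≡ ⊕) × ¬ (f ≡ e)) ×
            (∀ f → Z f ≡ ⊖ → (X f ≡ ⊖ ⊎ Y f ≡ ⊖) × ¬ (f ≡ e))

Independent : {E : Set} → (SignedSet E → Set) → (E → Set) → Set
Independent 𝒞 B = ¬ (Σ _ λ X → 𝒞 X × (∀ e → InSupp X e → B e))

IsBasis : {E : Set} → (SignedSet E → Set) → (E → Set) → Set
IsBasis 𝒞 B = Independent 𝒞 B ×
  (∀ e → ¬ B e → ¬ Independent 𝒞 (λ f → B f ⊎ f ≡ e))

data ST (n : ℕ) : Set where
  s t : Fin n → ST n

data STq (n : ℕ) : Set where
  s t : Fin n → STq n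
  q   : STq n

inj : {n : ℕ} → ST n → STq n
inj (ST.s i) = STq.s i
inj (ST.t i) = STq.t i

InS : {n : ℕ} → ST n → Set
InS (ST.s i) = ⊤
InS (ST.t i) = ⊥

SignReversing : {n : ℕ} → SignedSet (ST n) → Set
SignReversing X = ∀ i → InSupp X (ST.s i) → InSupp X (ST.t i) →
  X (ST.s i) ≡ negS (X (ST.t i))

IsPMatroid : {n : ℕ} → (SignedSet (ST n) → Set) → Set
IsPMatroid 𝒞 = IsOrientedMatroid 𝒞 × IsBasis 𝒞 InS ×
  (∀ X → 𝒞 X → ¬ SignReversing X)

Deletion : {n : ℕ} → (SignedSet (STq n) → Set) → SignedSet (ST n) → Set
Deletion 𝒞 Z = Σ (SignedSet (STq _)) λ X → 𝒞 X × X STq.q ≡ ⊙ ×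
  (∀ e → Z e ≡ X (inj e))

IsPMatroidExtension : {n : ℕ} → (SignedSet (STq n) → Set) → Set
IsPMatroidExtension 𝒞 = IsPMatroid (Deletion 𝒞)

Complementary : {n : ℕ} → SignedSet (STq n) → Set
Complementary X = ∀ i → X (STq.s i) ≡ ⊙ ⊎ X (STq.t i) ≡ ⊙

{-# OPTIONS --safe #-}
-- Eliminating q between X and −Y by (C3) yields a circuit Z with Z_q = 0, hence a
-- circuit of the deletion, whose nonzero entries are taken from X or from −Y.  If Z
-- had the same nonzero sign σ on sᵢ and tᵢ, both entries could not come from X (X is
-- complementary), nor both from −Y (Y is complementary), and one from each would give
-- X_{sᵢ} = σ = −Y_{tᵢ} or X_{tᵢ} = σ = −Y_{sᵢ}, which the hypothesis on the pair
-- (X, Y) forbids.  So Z is sign-reversing, which a P-matroid does not allow.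
module Submission where

open import Defs
open import Data.Nat using (ℕ)
open import Data.Product using (_×_; _,_; Σ; proj₁; proj₂)
open import Data.Sum using (_⊎_; inj₁; inj₂; [_,_])
import Data.Sum as Sum
open import Data.Empty using (⊥; ⊥-elim)
open import Function using (_∘_)
open import Relation.Nullary using (¬_)
open import Relation.Binary.PropositionalEquality
  using (_≡_; _≢_; refl; sym; trans; cong)

negS-involutive : ∀ a → negS (negS a) ≡ a
negS-involutive ⊖ = refl
negS-involutive ⊙ = refl
negS-involutive ⊕ = refl

negS-flip : ∀ {a b} → a ≡ negS b → b ≡ negS a
negS-flip {a} {b} a≡-b = trans (sym (negS-involutive b)) (cong negS (sym a≡-b))

negS-nonzero : ∀ {σ} → σ ≢ ⊙ → negS σ ≢ ⊙
negS-nonzero {⊖} _ ()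
negS-nonzero {⊙} σ≢⊙ = σ≢⊙
negS-nonzero {⊕} _ ()

nonzero≢negS : ∀ {σ} → σ ≢ ⊙ → σ ≢ negS σ
nonzero≢negS {⊙} σ≢⊙ = σ≢⊙
nonzero≢negS {⊖} _ ()
nonzero≢negS {⊕} _ ()

nonzero·negS-nonzero : ∀ {σ} → σ ≢ ⊙ → σ · negS σ ≢ ⊙
nonzero·negS-nonzero {⊙} σ≢⊙ = σ≢⊙
nonzero·negS-nonzero {⊖} _ ()
nonzero·negS-nonzero {⊕} _ ()

nonzero-equal-or-opposite : ∀ {a b} → a ≢ ⊙ → b ≢ ⊙ → a ≡ negS b ⊎ a ≡ b
nonzero-equal-or-opposite {⊙} a≢⊙ _ = ⊥-elim (a≢⊙ refl)
nonzero-equal-or-opposite {_} {⊙} _ b≢⊙ = ⊥-elim (b≢⊙ refl)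
nonzero-equal-or-opposite {⊖} {⊖} _ _ = inj₂ refl
nonzero-equal-or-opposite {⊖} {⊕} _ _ = inj₁ refl
nonzero-equal-or-opposite {⊕} {⊖} _ _ = inj₁ refl
nonzero-equal-or-opposite {⊕} {⊕} _ _ = inj₂ refl

sign-covered : ∀ {z a b} → (z ≡ ⊕ → a ≡ ⊕ ⊎ b ≡ ⊕) → (z ≡ ⊖ → a ≡ ⊖ ⊎ b ≡ ⊖) →
  z ≢ ⊙ → z ≡ a ⊎ z ≡ b
sign-covered {⊕} pos _ _ = Sum.map sym sym (pos refl)
sign-covered {⊖} _ neg _ = Sum.map sym sym (neg refl)
sign-covered {⊙} _ _ z≢⊙ = ⊥-elim (z≢⊙ refl)

sign-zero : ∀ {z} → z ≢ ⊕ → z ≢ ⊖ → z ≡ ⊙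
sign-zero {⊕} z≢⊕ _ = ⊥-elim (z≢⊕ refl)
sign-zero {⊖} _ z≢⊖ = ⊥-elim (z≢⊖ refl)
sign-zero {⊙} _ _ = refl

module _ {E : Set} {𝒞 : SignedSet E → Set} (om : IsOrientedMatroid 𝒞) where
  open IsOrientedMatroid om

  eliminate : ∀ X Y → 𝒞 X → 𝒞 Y → ¬ (X ≗ₛ Y) → ∀ e → X e ≡ ⊕ → Y e ≡ ⊕ →
    Σ (SignedSet E) λ Z → 𝒞 Z × Z e ≡ ⊙ ×
      (∀ f → Z f ≢ ⊙ → Z f ≡ X f ⊎ Z f ≡ negS (Y f))
  eliminate X Y 𝒞X 𝒞Y X≉Y e Xe Ye
    with C3 X (neg Y) 𝒞X (proj₁ (C1 Y) 𝒞Y) X≉−−Y e Xe (cong negS Ye)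
    where
    X≉−−Y : ¬ (X ≗ₛ neg (neg Y))
    X≉−−Y X≗−−Y = X≉Y λ f → trans (X≗−−Y f) (negS-involutive (Y f))
  ... | Z , 𝒞Z , pos , neg =
    Z , 𝒞Z ,
    sign-zero (λ Ze → proj₂ (pos e Ze) refl)
              (λ Ze → proj₂ (neg e Ze) refl) ,
    λ f → sign-covered (proj₁ ∘ pos f) (proj₁ ∘ neg f)

Compatible : Sign → Sign → Sign → Sign → Set
Compatible xs xt ys yt = (xs · yt ≡ ⊙ × xt · ys ≡ ⊙) ⊎ (xs ≡ yt × xt ≡ ys)

no-common-sign : ∀ {σ xs xt ys yt} → σ ≢ ⊙ →
  xs ≡ ⊙ ⊎ xt ≡ ⊙ → ys ≡ ⊙ ⊎ yt ≡ ⊙ → Compatible xs xt ys yt →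
  xs ≡ σ ⊎ ys ≡ negS σ → xt ≡ σ ⊎ yt ≡ negS σ → ⊥
no-common-sign σ≢⊙ compX _ _ (inj₁ refl) (inj₁ refl) = [ σ≢⊙ , σ≢⊙ ] compX
no-common-sign σ≢⊙ _ compY _ (inj₂ refl) (inj₂ refl) =
  [ negS-nonzero σ≢⊙ , negS-nonzero σ≢⊙ ] compY
no-common-sign σ≢⊙ _ _ (inj₁ (σ·−σ≡⊙ , _)) (inj₁ refl) (inj₂ refl) =
  nonzero·negS-nonzero σ≢⊙ σ·−σ≡⊙
no-common-sign σ≢⊙ _ _ (inj₂ (σ≡−σ , _)) (inj₁ refl) (inj₂ refl) =
  nonzero≢negS σ≢⊙ σ≡−σ
no-common-sign σ≢⊙ _ _ (inj₁ (_ , σ·−σ≡⊙)) (inj₂ refl) (inj₁ refl) =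
  nonzero·negS-nonzero σ≢⊙ σ·−σ≡⊙
no-common-sign σ≢⊙ _ _ (inj₂ (_ , σ≡−σ)) (inj₂ refl) (inj₁ refl) =
  nonzero≢negS σ≢⊙ σ≡−σ

compatible-composition-reversing : ∀ {xs xt ys yt zs zt} →
  xs ≡ ⊙ ⊎ xt ≡ ⊙ → ys ≡ ⊙ ⊎ yt ≡ ⊙ → Compatible xs xt ys yt →
  (zs ≢ ⊙ → zs ≡ xs ⊎ zs ≡ negS ys) → (zt ≢ ⊙ → zt ≡ xt ⊎ zt ≡ negS yt) →
  zs ≢ ⊙ → zt ≢ ⊙ → zs ≡ negS zt
compatible-composition-reversing compX compY compat fromS fromT zs≢⊙ zt≢⊙
  with nonzero-equal-or-opposite zs≢⊙ zt≢⊙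
... | inj₁ zs≡−zt = zs≡−zt
... | inj₂ refl = ⊥-elim (no-common-sign zs≢⊙ compX compY compat
  (Sum.map sym negS-flip (fromS zs≢⊙)) (Sum.map sym negS-flip (fromT zt≢⊙)))

lemma5p3 : (n : ℕ) (𝒞 : SignedSet (STq n) → Set) → IsOrientedMatroid 𝒞 →
    (X Y : SignedSet (STq n)) → 𝒞 X → 𝒞 Y → ¬ (X ≗ₛ Y) →
    Complementary X → Complementary Y →
    X STq.q ≡ ⊕ → Y STq.q ≡ ⊕ →
    (∀ i → ((X (STq.s i) · Y (STq.t i)) ≡ ⊙ × (X (STq.t i) · Y (STq.s i)) ≡ ⊙)
         ⊎ (X (STq.s i) ≡ Y (STq.t i) × X (STq.t i) ≡ Y (STq.s i))) →
    ¬ IsPMatroidExtension 𝒞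
lemma5p3 n 𝒞 om X Y 𝒞X 𝒞Y X≉Y compX compY Xq Yq compat (_ , _ , noSignReversing)
  with eliminate om X Y 𝒞X 𝒞Y X≉Y STq.q Xq Yq
... | Z , 𝒞Z , Zq , fromXor−Y =
  noSignReversing (Z ∘ inj) (Z , 𝒞Z , Zq , λ _ → refl) reversing
  where
  reversing : SignReversing (Z ∘ inj)
  reversing i = compatible-composition-reversing (compX i) (compY i) (compat i)
    (fromXor−Y (STq.s i)) (fromXor−Y (STq.t i))
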